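{- Let $r\ge1$ be an integer and let $z=z(x)$ be the formal power series solution of $x=z(1-z^r)$ with $z=x+O(x^2)$. Then for each $i\in\{0,1,\dots,r-1\}$ the formal power series $\xi_i(x):=\frac{d}{dx}\left(\frac{z^{i+1}}{i+1}\right)$ satisfies $$\xi_i(x)=\sum_{\substack{\mu\ge0\\ r\mid \mu-i}}\binom{\mu+[\mu]}{\mu}x^\mu .$$
   Context: For an integer $a$ write $a=r[a]+\langle a\rangle$ with $0\le\langle a\rangle\le r-1$ (Euclidean division by $r$). -}

module Defs where

open import Data.Nat as ℕ using (ℕ; zero; suc; _∸_)
open import Data.Integer using (ℤ; +_)
open import Data.Rational using (ℚ; 0ℚ; 1ℚ; _+_; _*_; _-_; _/_)

-- Formal power series over ℚ, as coefficient sequences: f n = [x^n] f.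
Series : Set
Series = ℕ → ℚ

X : Series
X 1 = 1ℚ
X _ = 0ℚ

one : Series
one 0 = 1ℚ
one _ = 0ℚ

sumBelow : (ℕ → ℚ) → ℕ → ℚ
sumBelow h zero    = 0ℚ
sumBelow h (suc n) = sumBelow h n + h n

_⊛_ : Series → Series → Series
(f ⊛ g) n = sumBelow (λ k → f k * g (n ∸ k)) (suc n)

_⊖_ : Series → Series → Series
(f ⊖ g) n = f n - g n

pow : Series → ℕ → Series
pow f zero    = one
pow f (suc n) = f ⊛ pow f n

scale : ℚ → Series → Series
scale c f n = c * f n

deriv : Series → Series
deriv f n = (+ suc n / 1) * f (suc n)

ξ : Series → ℕ → Series
ξ z i = deriv (scale (+ 1 / suc i) (pow z (suc i)))

-- Let c(n, k) = [xⁿ] zᵏ. Since x = z − z^{r+1}, we have z^{k+1} = x zᵏ + z^{k+1+r}, that is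
-- c(n+1, k+1) = c(n, k) + c(n+1, k+1+r); with c(k, k) = 1 and c(n, k) = 0 for n < k this recurrence
-- determines every coefficient. Hence c(n, k) = 0 unless n = k + r m, and, by induction on (m, k),
-- c(k + r m, k) = C(N, m) − r C(N, m − 1) with N = k + r m + m − 1, because the right-hand side obeys
-- the same recurrence by Pascal's rule. Finally ξ_i(μ) = (μ+1)/(i+1) · c(μ+1, i+1), and for μ = i + r q
-- the absorption identity q C(N, q) = (N − q + 1) C(N, q − 1) turns this into C(μ + q, q).

module Submission where

open import Defs
open import Data.Nat using (ℕ; _<_; NonZero) renaming (_/_ to _div_; _+_ to _+ℕ_)
open import Data.Nat.Combinatorics using (_C_)
open import Data.Integer using (+_; _-_)
open import Data.Integer.Divisibility using (_∣_)
open import Data.Rational using (ℚ; 0ℚ; 1ℚ; _/_)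
open import Data.Product using (_×_)
open import Relation.Nullary using (¬_)
open import Relation.Binary.PropositionalEquality using (_≡_)

open import Data.Nat using (zero; suc; _≤_; _∸_; _%_; s≤s; >-nonZero; >-nonZero⁻¹) renaming (_*_ to _*ℕ_)
import Data.Nat.Properties as ℕ
open import Data.Nat.DivMod using (m≡m%n+[m/n]*n; m%n<n; +-distrib-/-∣ʳ; m*n/n≡m; m<n⇒m/n≡0)
import Data.Nat.Divisibility as ℕ
open import Data.Nat.Combinatorics using (nCk+nC[k+1]≡[n+1]C[k+1]; nC1≡n; nCn≡1; nCk≡nC[n∸k])
open import Data.Nat.Tactic.RingSolver using (solve-∀)
import Data.Integer as ℤ
import Data.Integer.Properties as ℤ
open import Data.Rational using (_+_; _*_; toℚᵘ) renaming (_-_ to _-ℚ_)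
open import Data.Rational.Properties
  using (+-identityˡ; +-identityʳ; +-assoc; +-inverseʳ; *-assoc; *-identityˡ; *-identityʳ;
         *-zeroˡ; *-zeroʳ; *-distribˡ-+; *-distribʳ-+;
         toℚᵘ-injective; toℚᵘ-fromℚᵘ; toℚᵘ-homo-+; toℚᵘ-homo-*)
open import Data.Rational.Unnormalised as ℚᵘ using (mkℚᵘ; *≡*)
import Data.Rational.Unnormalised.Properties as ℚᵘ
open import Data.Rational.Solver using (module +-*-Solver)
open import Data.Product using (∃; _,_)
open import Data.Empty using (⊥-elim)
open import Function using (_∘_)
open import Relation.Nullary using (yes; no)
open import Relation.Binary.PropositionalEquality using (refl; sym; trans; cong; cong₂; subst; module ≡-Reasoning)

open +-*-Solver using (solve; _:=_; _:+_; _:*_; _:-_)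

sumBelow-suc : ∀ (h : ℕ → ℚ) n → sumBelow h (suc n) ≡ h 0 + sumBelow (h ∘ suc) n
sumBelow-suc h zero    = trans (+-identityˡ (h 0)) (sym (+-identityʳ (h 0)))
sumBelow-suc h (suc n) = trans (cong (_+ h (suc n)) (sumBelow-suc h n)) (+-assoc (h 0) _ _)

sumBelow-cong : ∀ {g h : ℕ → ℚ} n → (∀ k → g k ≡ h k) → sumBelow g n ≡ sumBelow h n
sumBelow-cong zero    g≡h = refl
sumBelow-cong (suc n) g≡h = cong₂ _+_ (sumBelow-cong n g≡h) (g≡h n)

sumBelow-+ : ∀ (g h : ℕ → ℚ) n → sumBelow (λ k → g k + h k) n ≡ sumBelow g n + sumBelow h n
sumBelow-+ g h zero    = refl
sumBelow-+ g h (suc n) =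
  trans (cong (_+ (g n + h n)) (sumBelow-+ g h n))
        (solve 4 (λ a b c d → (a :+ b) :+ (c :+ d) := (a :+ c) :+ (b :+ d)) refl
               (sumBelow g n) (sumBelow h n) (g n) (h n))

sumBelow-*ˡ : ∀ c (h : ℕ → ℚ) n → sumBelow (λ k → c * h k) n ≡ c * sumBelow h n
sumBelow-*ˡ c h zero    = sym (*-zeroʳ c)
sumBelow-*ˡ c h (suc n) = trans (cong (_+ (c * h n)) (sumBelow-*ˡ c h n)) (sym (*-distribˡ-+ c _ _))

sumBelow-zero : ∀ (h : ℕ → ℚ) n → (∀ k → h k ≡ 0ℚ) → sumBelow h n ≡ 0ℚ
sumBelow-zero h zero    h≡0 = refl
sumBelow-zero h (suc n) h≡0 = trans (cong₂ _+_ (sumBelow-zero h n h≡0) (h≡0 n)) (+-identityˡ 0ℚ)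

_⊕_ : Series → Series → Series
(f ⊕ g) n = f n + g n

shift : Series → Series
shift f n = f (suc n)

⊛-coeff-zero : ∀ f g → (f ⊛ g) 0 ≡ f 0 * g 0
⊛-coeff-zero f g = +-identityˡ _

⊛-coeff-suc : ∀ f g n → (f ⊛ g) (suc n) ≡ f 0 * g (suc n) + (shift f ⊛ g) n
⊛-coeff-suc f g n = sumBelow-suc _ (suc n)

⊛-congˡ : ∀ {f f′} g → (∀ k → f k ≡ f′ k) → ∀ n → (f ⊛ g) n ≡ (f′ ⊛ g) n
⊛-congˡ g f≡f′ n = sumBelow-cong (suc n) (λ k → cong (_* g (n ∸ k)) (f≡f′ k))

⊛-congʳ : ∀ f {g g′} → (∀ k → g k ≡ g′ k) → ∀ n → (f ⊛ g) n ≡ (f ⊛ g′) n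
⊛-congʳ f g≡g′ n = sumBelow-cong (suc n) (λ k → cong (f k *_) (g≡g′ (n ∸ k)))

⊛-distribˡ-⊕ : ∀ f g h n → (f ⊛ (g ⊕ h)) n ≡ (f ⊛ g) n + (f ⊛ h) n
⊛-distribˡ-⊕ f g h n =
  trans (sumBelow-cong (suc n) (λ k → *-distribˡ-+ (f k) (g (n ∸ k)) (h (n ∸ k)))) (sumBelow-+ _ _ (suc n))

⊛-distribʳ-⊕ : ∀ f g h n → ((f ⊕ g) ⊛ h) n ≡ (f ⊛ h) n + (g ⊛ h) n
⊛-distribʳ-⊕ f g h n =
  trans (sumBelow-cong (suc n) (λ k → *-distribʳ-+ (h (n ∸ k)) (f k) (g k))) (sumBelow-+ _ _ (suc n))

⊛-scaleˡ : ∀ c f g n → (scale c f ⊛ g) n ≡ c * (f ⊛ g) n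
⊛-scaleˡ c f g n = trans (sumBelow-cong (suc n) (λ k → *-assoc c (f k) (g (n ∸ k)))) (sumBelow-*ˡ c _ (suc n))

⊛-vanishˡ : ∀ f g n → (∀ k → f k ≡ 0ℚ) → (f ⊛ g) n ≡ 0ℚ
⊛-vanishˡ f g n f≡0 =
  sumBelow-zero _ (suc n) (λ k → trans (cong (_* g (n ∸ k)) (f≡0 k)) (*-zeroˡ (g (n ∸ k))))

⊛-vanishʳ : ∀ f g n → (∀ m → m ≤ n → g m ≡ 0ℚ) → (f ⊛ g) n ≡ 0ℚ
⊛-vanishʳ f g n g≡0 =
  sumBelow-zero _ (suc n) (λ k → trans (cong (f k *_) (g≡0 (n ∸ k) (ℕ.m∸n≤m n k))) (*-zeroʳ (f k)))

⊛-identityˡ : ∀ f n → (one ⊛ f) n ≡ f n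
⊛-identityˡ f zero    = trans (⊛-coeff-zero one f) (*-identityˡ (f 0))
⊛-identityˡ f (suc n) =
  trans (⊛-coeff-suc one f n)
        (trans (cong₂ _+_ (*-identityˡ (f (suc n))) (⊛-vanishˡ (shift one) f n (λ _ → refl)))
               (+-identityʳ _))

⊛-identityʳ : ∀ f n → (f ⊛ one) n ≡ f n
⊛-identityʳ f zero    = trans (⊛-coeff-zero f one) (*-identityʳ (f 0))
⊛-identityʳ f (suc n) =
  trans (⊛-coeff-suc f one n)
        (trans (cong₂ _+_ (*-zeroʳ (f 0)) (⊛-identityʳ (shift f) n)) (+-identityˡ _))

X-⊛ : ∀ f n → (X ⊛ f) (suc n) ≡ f n
X-⊛ f n =
  trans (⊛-coeff-suc X f n)
        (trans (cong₂ _+_ (*-zeroˡ (f (suc n))) (trans (⊛-congˡ f shiftX≡one n) (⊛-identityˡ f n)))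
               (+-identityˡ _))
  where
    shiftX≡one : ∀ k → shift X k ≡ one k
    shiftX≡one zero    = refl
    shiftX≡one (suc k) = refl

⊛-assoc : ∀ f g h n → ((f ⊛ g) ⊛ h) n ≡ (f ⊛ (g ⊛ h)) n
⊛-assoc f g h zero = begin
  ((f ⊛ g) ⊛ h) 0     ≡⟨ ⊛-coeff-zero (f ⊛ g) h ⟩
  (f ⊛ g) 0 * h 0     ≡⟨ cong (_* h 0) (⊛-coeff-zero f g) ⟩
  f 0 * g 0 * h 0     ≡⟨ *-assoc (f 0) (g 0) (h 0) ⟩
  f 0 * (g 0 * h 0)   ≡⟨ cong (f 0 *_) (sym (⊛-coeff-zero g h)) ⟩
  f 0 * (g ⊛ h) 0     ≡⟨ sym (⊛-coeff-zero f (g ⊛ h)) ⟩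
  (f ⊛ (g ⊛ h)) 0     ∎
  where open ≡-Reasoning
⊛-assoc f g h (suc n) = begin
  ((f ⊛ g) ⊛ h) (suc n)
    ≡⟨ ⊛-coeff-suc (f ⊛ g) h n ⟩
  (f ⊛ g) 0 * h (suc n) + (shift (f ⊛ g) ⊛ h) n
    ≡⟨ cong₂ _+_ (cong (_* h (suc n)) (⊛-coeff-zero f g)) (⊛-congˡ h (⊛-coeff-suc f g) n) ⟩
  f 0 * g 0 * h (suc n) + ((scale (f 0) (shift g) ⊕ (shift f ⊛ g)) ⊛ h) n
    ≡⟨ cong (_+_ (f 0 * g 0 * h (suc n))) (⊛-distribʳ-⊕ (scale (f 0) (shift g)) (shift f ⊛ g) h n) ⟩
  f 0 * g 0 * h (suc n) + ((scale (f 0) (shift g) ⊛ h) n + ((shift f ⊛ g) ⊛ h) n)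
    ≡⟨ cong (_+_ (f 0 * g 0 * h (suc n)))
            (cong₂ _+_ (⊛-scaleˡ (f 0) (shift g) h n) (⊛-assoc (shift f) g h n)) ⟩
  f 0 * g 0 * h (suc n) + (f 0 * (shift g ⊛ h) n + (shift f ⊛ (g ⊛ h)) n)
    ≡⟨ solve 5 (λ a b c d e → a :* b :* c :+ (a :* d :+ e) := a :* (b :* c :+ d) :+ e) refl
             (f 0) (g 0) (h (suc n)) ((shift g ⊛ h) n) ((shift f ⊛ (g ⊛ h)) n) ⟩
  f 0 * (g 0 * h (suc n) + (shift g ⊛ h) n) + (shift f ⊛ (g ⊛ h)) n
    ≡⟨ cong (λ c → f 0 * c + (shift f ⊛ (g ⊛ h)) n) (sym (⊛-coeff-suc g h n)) ⟩
  f 0 * (g ⊛ h) (suc n) + (shift f ⊛ (g ⊛ h)) n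
    ≡⟨ sym (⊛-coeff-suc f (g ⊛ h) n) ⟩
  (f ⊛ (g ⊛ h)) (suc n) ∎
  where open ≡-Reasoning

pow-+ : ∀ f a b n → (pow f a ⊛ pow f b) n ≡ pow f (a +ℕ b) n
pow-+ f zero    b n = ⊛-identityˡ (pow f b) n
pow-+ f (suc a) b n = trans (⊛-assoc f (pow f a) (pow f b) n) (⊛-congʳ f (pow-+ f a b) n)

pow-vanish : ∀ f → f 0 ≡ 0ℚ → ∀ k n → n < k → pow f k n ≡ 0ℚ
pow-vanish f f₀≡0 (suc k) zero    _ =
  trans (⊛-coeff-zero f (pow f k)) (trans (cong (_* pow f k 0) f₀≡0) (*-zeroˡ (pow f k 0)))
pow-vanish f f₀≡0 (suc k) (suc n) (s≤s n<k) =
  trans (⊛-coeff-suc f (pow f k) n)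
        (trans (cong₂ _+_ (trans (cong (_* pow f k (suc n)) f₀≡0) (*-zeroˡ (pow f k (suc n))))
                          (⊛-vanishʳ (shift f) (pow f k) n
                             (λ m m≤n → pow-vanish f f₀≡0 k m (ℕ.≤-<-trans m≤n n<k))))
               (+-identityˡ 0ℚ))

ι : ℕ → ℚ
ι n = + n / 1

toℚᵘ-ι : ∀ n → toℚᵘ (ι n) ℚᵘ.≃ mkℚᵘ (+ n) 0
toℚᵘ-ι n = toℚᵘ-fromℚᵘ (mkℚᵘ (+ n) 0)

ι-homo-+ : ∀ a b → ι (a +ℕ b) ≡ ι a + ι b
ι-homo-+ a b = toℚᵘ-injective (begin
  toℚᵘ (ι (a +ℕ b))
    ≈⟨ toℚᵘ-ι (a +ℕ b) ⟩
  mkℚᵘ (+ (a +ℕ b)) 0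
    ≈⟨ *≡* (trans (cong (ℤ._* ℤ.1ℤ) (ℤ.pos-+ a b)) (unit-denominators (+ a) (+ b))) ⟩
  mkℚᵘ (+ a) 0 ℚᵘ.+ mkℚᵘ (+ b) 0
    ≈⟨ ℚᵘ.+-cong (ℚᵘ.≃-sym (toℚᵘ-ι a)) (ℚᵘ.≃-sym (toℚᵘ-ι b)) ⟩
  toℚᵘ (ι a) ℚᵘ.+ toℚᵘ (ι b)
    ≈⟨ ℚᵘ.≃-sym (toℚᵘ-homo-+ (ι a) (ι b)) ⟩
  toℚᵘ (ι a + ι b) ∎)
  where
    open ℚᵘ.≃-Reasoning
    unit-denominators : ∀ x y →
                        (x ℤ.+ y) ℤ.* ℤ.1ℤ ≡ (x ℤ.* ℤ.1ℤ ℤ.+ y ℤ.* ℤ.1ℤ) ℤ.* ℤ.1ℤ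
    unit-denominators x y =
      cong (ℤ._* ℤ.1ℤ) (sym (cong₂ ℤ._+_ (ℤ.*-identityʳ x) (ℤ.*-identityʳ y)))

ι-homo-* : ∀ a b → ι (a *ℕ b) ≡ ι a * ι b
ι-homo-* a b = toℚᵘ-injective (begin
  toℚᵘ (ι (a *ℕ b))
    ≈⟨ toℚᵘ-ι (a *ℕ b) ⟩
  mkℚᵘ (+ (a *ℕ b)) 0
    ≈⟨ *≡* (cong (ℤ._* ℤ.1ℤ) (ℤ.pos-* a b)) ⟩
  mkℚᵘ (+ a) 0 ℚᵘ.* mkℚᵘ (+ b) 0
    ≈⟨ ℚᵘ.*-cong (ℚᵘ.≃-sym (toℚᵘ-ι a)) (ℚᵘ.≃-sym (toℚᵘ-ι b)) ⟩
  toℚᵘ (ι a) ℚᵘ.* toℚᵘ (ι b)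
    ≈⟨ ℚᵘ.≃-sym (toℚᵘ-homo-* (ι a) (ι b)) ⟩
  toℚᵘ (ι a * ι b) ∎)
  where open ℚᵘ.≃-Reasoning

1/[1+n]*[1+n]≡1 : ∀ n → (+ 1 / suc n) * ι (suc n) ≡ 1ℚ
1/[1+n]*[1+n]≡1 n = toℚᵘ-injective (begin
  toℚᵘ ((+ 1 / suc n) * ι (suc n))
    ≈⟨ toℚᵘ-homo-* (+ 1 / suc n) (ι (suc n)) ⟩
  toℚᵘ (+ 1 / suc n) ℚᵘ.* toℚᵘ (ι (suc n))
    ≈⟨ ℚᵘ.*-cong (toℚᵘ-fromℚᵘ (mkℚᵘ (+ 1) n)) (toℚᵘ-ι (suc n)) ⟩
  mkℚᵘ (+ 1) n ℚᵘ.* mkℚᵘ (+ suc n) 0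
    ≈⟨ *≡* (ℤ.*-assoc ℤ.1ℤ (+ suc n) ℤ.1ℤ) ⟩
  ℚᵘ.1ℚᵘ ∎)
  where open ℚᵘ.≃-Reasoning

absorption : ∀ n k → suc k *ℕ (suc (n +ℕ k) C suc k) ≡ suc n *ℕ (suc (n +ℕ k) C k)
absorption n zero = begin
  1 *ℕ (suc (n +ℕ 0) C 1)  ≡⟨ ℕ.*-identityˡ _ ⟩
  suc (n +ℕ 0) C 1         ≡⟨ nC1≡n (suc (n +ℕ 0)) ⟩
  suc (n +ℕ 0)             ≡⟨ cong suc (ℕ.+-identityʳ n) ⟩
  suc n                    ≡⟨ ℕ.*-identityʳ (suc n) ⟨
  suc n *ℕ 1               ∎
  where open ≡-Reasoning
absorption zero (suc k) = begin
  suc (suc k) *ℕ (suc (suc k) C suc (suc k))  ≡⟨ cong (suc (suc k) *ℕ_) (nCn≡1 (suc (suc k))) ⟩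
  suc (suc k) *ℕ 1                            ≡⟨ ℕ.*-identityʳ (suc (suc k)) ⟩
  suc (suc k)                                 ≡⟨ nC1≡n (suc (suc k)) ⟨
  suc (suc k) C 1                             ≡⟨ cong (suc (suc k) C_) (ℕ.m+n∸n≡m 1 (suc k)) ⟨
  suc (suc k) C (suc (suc k) ∸ suc k)         ≡⟨ nCk≡nC[n∸k] (ℕ.n≤1+n (suc k)) ⟨
  suc (suc k) C suc k                         ≡⟨ ℕ.*-identityˡ _ ⟨
  1 *ℕ (suc (suc k) C suc k)                  ∎
  where open ≡-Reasoning
absorption (suc n) (suc k) = begin
  suc (suc k) *ℕ (suc M C suc (suc k))
    ≡⟨ cong (suc (suc k) *ℕ_) (nCk+nC[k+1]≡[n+1]C[k+1] M (suc k)) ⟨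
  suc (suc k) *ℕ (Ck+1 +ℕ Ck+2)
    ≡⟨ ℕ.*-distribˡ-+ (suc (suc k)) Ck+1 Ck+2 ⟩
  suc (suc k) *ℕ Ck+1 +ℕ suc (suc k) *ℕ Ck+2
    ≡⟨ cong (suc (suc k) *ℕ Ck+1 +ℕ_) (absorption n (suc k)) ⟩
  suc (suc k) *ℕ Ck+1 +ℕ suc n *ℕ Ck+1
    ≡⟨ trade-one k n Ck+1 ⟩
  suc k *ℕ Ck+1 +ℕ suc (suc n) *ℕ Ck+1
    ≡⟨ cong (_+ℕ suc (suc n) *ℕ Ck+1) absorption-n+1 ⟩
  suc (suc n) *ℕ Ck +ℕ suc (suc n) *ℕ Ck+1
    ≡⟨ ℕ.*-distribˡ-+ (suc (suc n)) Ck Ck+1 ⟨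
  suc (suc n) *ℕ (Ck +ℕ Ck+1)
    ≡⟨ cong (suc (suc n) *ℕ_) (nCk+nC[k+1]≡[n+1]C[k+1] M k) ⟩
  suc (suc n) *ℕ (suc M C suc k) ∎
  where
    open ≡-Reasoning
    M = suc n +ℕ suc k
    Ck = M C k
    Ck+1 = M C suc k
    Ck+2 = M C suc (suc k)
    trade-one : ∀ k n x → suc (suc k) *ℕ x +ℕ suc n *ℕ x ≡ suc k *ℕ x +ℕ suc (suc n) *ℕ x
    trade-one = solve-∀
    absorption-n+1 : suc k *ℕ Ck+1 ≡ suc (suc n) *ℕ Ck
    absorption-n+1 = subst (λ N → suc k *ℕ (N C suc k) ≡ suc (suc n) *ℕ (N C k))
                           (cong suc (sym (ℕ.+-suc n k))) (absorption (suc n) k)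

-- ballot r N m = C(N, m) − r C(N, m − 1); for N = k + r m + m − 1 it is the integer form of the
-- Lagrange-inversion coefficient k / (k + r m) · C(N, m).
ballot : ℕ → ℕ → ℕ → ℚ
ballot r N zero    = 1ℚ
ballot r N (suc m) = ι (N C suc m) -ℚ ι r * ι (N C m)

ballot-suc : ∀ r N m → ballot r (suc N) (suc m) ≡ ballot r N (suc m) + ballot r N m
ballot-suc r N zero = begin
  ι (suc N C 1) -ℚ ι r * 1ℚ
    ≡⟨ cong (λ c → ι c -ℚ ι r * 1ℚ) (nCk+nC[k+1]≡[n+1]C[k+1] N 0) ⟨
  ι (1 +ℕ N C 1) -ℚ ι r * 1ℚ
    ≡⟨ cong (_-ℚ ι r * 1ℚ) (ι-homo-+ 1 (N C 1)) ⟩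
  (1ℚ + ι (N C 1)) -ℚ ι r * 1ℚ
    ≡⟨ solve 3 (λ o a b → (o :+ a) :- b :* o := (a :- b :* o) :+ o) refl 1ℚ (ι (N C 1)) (ι r) ⟩
  (ι (N C 1) -ℚ ι r * 1ℚ) + 1ℚ ∎
  where open ≡-Reasoning
ballot-suc r N (suc m) = begin
  ι (suc N C suc (suc m)) -ℚ ι r * ι (suc N C suc m)
    ≡⟨ cong₂ (λ a b → ι a -ℚ ι r * ι b) (sym (nCk+nC[k+1]≡[n+1]C[k+1] N (suc m)))
                                         (sym (nCk+nC[k+1]≡[n+1]C[k+1] N m)) ⟩
  ι (N C suc m +ℕ N C suc (suc m)) -ℚ ι r * ι (N C m +ℕ N C suc m)
    ≡⟨ cong₂ (λ a b → a -ℚ ι r * b) (ι-homo-+ (N C suc m) (N C suc (suc m)))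
                                     (ι-homo-+ (N C m) (N C suc m)) ⟩
  (ι (N C suc m) + ι (N C suc (suc m))) -ℚ ι r * (ι (N C m) + ι (N C suc m))
    ≡⟨ solve 4 (λ a b c ρ → (b :+ c) :- ρ :* (a :+ b) := (c :- ρ :* b) :+ (b :- ρ :* a)) refl
               (ι (N C m)) (ι (N C suc m)) (ι (N C suc (suc m))) (ι r) ⟩
  (ι (N C suc (suc m)) -ℚ ι r * ι (N C suc m)) + (ι (N C suc m) -ℚ ι r * ι (N C m)) ∎
  where open ≡-Reasoning

-- The case k = 0 of the formula: [x^{r(m+1)}] z⁰ = 0.
ballot-vanish : ∀ r .{{_ : NonZero r}} m → ballot r (r *ℕ suc m +ℕ m) (suc m) ≡ 0ℚ
ballot-vanish (suc r) m = begin
  ι (N C suc m) -ℚ ι (suc r) * ι (N C m)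
    ≡⟨ cong (λ c → ι c -ℚ ι (suc r) * ι (N C m)) C[N,m+1]≡[r+1]C[N,m] ⟩
  ι (suc r *ℕ (N C m)) -ℚ ι (suc r) * ι (N C m)
    ≡⟨ cong (_-ℚ ι (suc r) * ι (N C m)) (ι-homo-* (suc r) (N C m)) ⟩
  ι (suc r) * ι (N C m) -ℚ ι (suc r) * ι (N C m)
    ≡⟨ +-inverseʳ (ι (suc r) * ι (N C m)) ⟩
  0ℚ ∎
  where
    open ≡-Reasoning
    N = suc r *ℕ suc m +ℕ m
    regroup : ∀ r m x → suc r *ℕ suc m *ℕ x ≡ suc m *ℕ (suc r *ℕ x)
    regroup = solve-∀
    C[N,m+1]≡[r+1]C[N,m] : N C suc m ≡ suc r *ℕ (N C m)
    C[N,m+1]≡[r+1]C[N,m] = ℕ.*-cancelˡ-≡ _ _ (suc m)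
      (trans (absorption (m +ℕ r *ℕ suc m) m) (regroup r m (N C m)))

lagrange-prefactor : ∀ r i q →
  ι (suc (i +ℕ r *ℕ q)) * ballot r (i +ℕ r *ℕ q +ℕ q) q ≡ ι (suc i) * ι ((i +ℕ r *ℕ q +ℕ q) C q)
lagrange-prefactor r i zero =
  trans (*-identityʳ _) (trans (cong (ι ∘ suc) i+r*0≡i) (sym (*-identityʳ (ι (suc i)))))
  where
    i+r*0≡i : i +ℕ r *ℕ 0 ≡ i
    i+r*0≡i = trans (cong (i +ℕ_) (ℕ.*-zeroʳ r)) (ℕ.+-identityʳ i)
lagrange-prefactor r i (suc s) = begin
  ι (suc μ) * (ι B -ℚ ι r * ι A)
    ≡⟨ solve 4 (λ a b ρ x → x :* (b :- ρ :* a) := b :* x :- ρ :* (x :* a)) refl (ι A) (ι B) (ι r) (ι (suc μ)) ⟩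
  ι B * ι (suc μ) -ℚ ι r * (ι (suc μ) * ι A)
    ≡⟨ cong₂ (λ x y → ι B * x -ℚ ι r * y) ι[1+μ] absorbed ⟩
  ι B * (ι (suc i) + ι r * ι (suc s)) -ℚ ι r * (ι (suc s) * ι B)
    ≡⟨ solve 4 (λ b j ρ q → b :* (j :+ ρ :* q) :- ρ :* (q :* b) := j :* b) refl (ι B) (ι (suc i)) (ι r) (ι (suc s)) ⟩
  ι (suc i) * ι B ∎
  where
    open ≡-Reasoning
    μ = i +ℕ r *ℕ suc s
    A = (μ +ℕ suc s) C s
    B = (μ +ℕ suc s) C suc s
    ι[1+μ] : ι (suc μ) ≡ ι (suc i) + ι r * ι (suc s)
    ι[1+μ] = trans (ι-homo-+ (suc i) (r *ℕ suc s)) (cong (_+_ (ι (suc i))) (ι-homo-* r (suc s)))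
    [1+μ]A≡[1+s]B : suc μ *ℕ A ≡ suc s *ℕ B
    [1+μ]A≡[1+s]B = subst (λ N → suc μ *ℕ (N C s) ≡ suc s *ℕ (N C suc s)) (sym (ℕ.+-suc μ s))
                          (sym (absorption μ s))
    absorbed : ι (suc μ) * ι A ≡ ι (suc s) * ι B
    absorbed = trans (sym (ι-homo-* (suc μ) A)) (trans (cong ι [1+μ]A≡[1+s]B) (ι-homo-* (suc s) B))

C-swap : ∀ n k → (n +ℕ k) C k ≡ (n +ℕ k) C n
C-swap n k = trans (nCk≡nC[n∸k] (ℕ.m≤n+m k n)) (cong ((n +ℕ k) C_) (ℕ.m+n∸n≡m n k))

∣⇒on-progression : ∀ {r i μ} → i < r → + r ∣ (+ μ - + i) → ∃ λ q → μ ≡ i +ℕ r *ℕ q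
∣⇒on-progression {r} {i} {μ} i<r r∣μ-i with i ℕ.≤? μ
... | yes i≤μ with subst (r ℕ.∣_) (cong ℤ.∣_∣ (trans (ℤ.m-n≡m⊖n μ i) (ℤ.⊖-≥ i≤μ))) r∣μ-i
...   | ℕ.divides q μ∸i≡q*r =
  q , trans (sym (ℕ.m+[n∸m]≡n i≤μ)) (cong (i +ℕ_) (trans μ∸i≡q*r (ℕ.*-comm q r)))
∣⇒on-progression {r} {i} {μ} i<r r∣μ-i | no i≰μ = ⊥-elim (ℕ.<-irrefl refl (ℕ.<-≤-trans i<r r≤i))
  where
    μ<i = ℕ.≰⇒> i≰μ
    instance
      i∸μ≢0 : NonZero (i ∸ μ)
      i∸μ≢0 = >-nonZero (ℕ.m<n⇒0<n∸m μ<i)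
    r∣i∸μ : r ℕ.∣ (i ∸ μ)
    r∣i∸μ = subst (r ℕ.∣_) (trans (cong ℤ.∣_∣ (ℤ.m-n≡m⊖n μ i)) (ℤ.∣⊖∣-< μ<i)) r∣μ-i
    r≤i : r ≤ i
    r≤i = ℕ.≤-trans (ℕ.∣⇒≤ r∣i∸μ) (ℕ.m∸n≤m i μ)

on-progression⇒∣ : ∀ r i q → + r ∣ (+ (i +ℕ r *ℕ q) - + i)
on-progression⇒∣ r i q = subst (r ℕ.∣_) (sym ∣μ-i∣≡r*q) (ℕ.m∣m*n q)
  where
    ∣μ-i∣≡r*q : ℤ.∣ + (i +ℕ r *ℕ q) - + i ∣ ≡ r *ℕ q
    ∣μ-i∣≡r*q = begin
      ℤ.∣ + (i +ℕ r *ℕ q) - + i ∣   ≡⟨ cong ℤ.∣_∣ (ℤ.m-n≡m⊖n (i +ℕ r *ℕ q) i) ⟩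
      ℤ.∣ (i +ℕ r *ℕ q) ℤ.⊖ i ∣     ≡⟨ cong ℤ.∣_∣ (ℤ.⊖-≥ (ℕ.m≤m+n i (r *ℕ q))) ⟩
      i +ℕ r *ℕ q ∸ i               ≡⟨ ℕ.m+n∸m≡n i (r *ℕ q) ⟩
      r *ℕ q                        ∎
      where open ≡-Reasoning

on-progression-div : ∀ r .{{_ : NonZero r}} {i} q → i < r → (i +ℕ r *ℕ q) div r ≡ q
on-progression-div r {i} q i<r = begin
  (i +ℕ r *ℕ q) div r
    ≡⟨ +-distrib-/-∣ʳ i (ℕ.m∣m*n q) ⟩
  i div r +ℕ (r *ℕ q) div r
    ≡⟨ cong₂ _+ℕ_ (m<n⇒m/n≡0 i<r) (trans (cong (_div r) (ℕ.*-comm r q)) (m*n/n≡m q r)) ⟩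
  q ∎
  where open ≡-Reasoning

one-nonZero : ∀ n .{{_ : NonZero n}} → one n ≡ 0ℚ
one-nonZero (suc n) = refl

module Coefficients (r : ℕ) .{{_ : NonZero r}} (z : Series) (z₀≡0 : z 0 ≡ 0ℚ)
                    (x≡z[1-zʳ] : ∀ n → X n ≡ (z ⊛ (one ⊖ pow z r)) n) where

  open ≡-Reasoning

  z≡x+zʳ⁺¹ : ∀ n → z n ≡ (X ⊕ pow z (suc r)) n
  z≡x+zʳ⁺¹ n = begin
    z n
      ≡⟨ ⊛-identityʳ z n ⟨
    (z ⊛ one) n
      ≡⟨ ⊛-congʳ z (λ k → a-b+b (one k) (pow z r k)) n ⟨
    (z ⊛ ((one ⊖ pow z r) ⊕ pow z r)) n
      ≡⟨ ⊛-distribˡ-⊕ z (one ⊖ pow z r) (pow z r) n ⟩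
    (z ⊛ (one ⊖ pow z r)) n + pow z (suc r) n
      ≡⟨ cong (_+ pow z (suc r) n) (x≡z[1-zʳ] n) ⟨
    X n + pow z (suc r) n ∎
    where
      a-b+b : ∀ a b → (a -ℚ b) + b ≡ a
      a-b+b = solve 2 (λ a b → (a :- b) :+ b := a) refl

  pow-coeff-suc : ∀ k n → pow z (suc k) (suc n) ≡ pow z k n + pow z (suc k +ℕ r) (suc n)
  pow-coeff-suc k n = begin
    pow z (suc k) (suc n)
      ≡⟨ ⊛-congˡ (pow z k) z≡x+zʳ⁺¹ (suc n) ⟩
    ((X ⊕ pow z (suc r)) ⊛ pow z k) (suc n)
      ≡⟨ ⊛-distribʳ-⊕ X (pow z (suc r)) (pow z k) (suc n) ⟩
    (X ⊛ pow z k) (suc n) + (pow z (suc r) ⊛ pow z k) (suc n)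
      ≡⟨ cong₂ _+_ (X-⊛ (pow z k) n) (pow-+ z (suc r) k (suc n)) ⟩
    pow z k n + pow z (suc r +ℕ k) (suc n)
      ≡⟨ cong (λ e → pow z k n + pow z (suc e) (suc n)) (ℕ.+-comm r k) ⟩
    pow z k n + pow z (suc k +ℕ r) (suc n) ∎

  pow-coeff-diag : ∀ k → pow z k k ≡ 1ℚ
  pow-coeff-diag zero    = refl
  pow-coeff-diag (suc k) = begin
    pow z (suc k) (suc k)
      ≡⟨ pow-coeff-suc k k ⟩
    pow z k k + pow z (suc k +ℕ r) (suc k)
      ≡⟨ cong₂ _+_ (pow-coeff-diag k) (pow-vanish z z₀≡0 (suc k +ℕ r) (suc k) k<k+r) ⟩
    1ℚ + 0ℚ
      ≡⟨ +-identityʳ 1ℚ ⟩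
    1ℚ ∎
    where
      k<k+r : suc k < suc k +ℕ r
      k<k+r = ℕ.m<m+n (suc k) (>-nonZero⁻¹ r)

  pow-coeff-on-progression : ∀ m k → pow z (suc k) (suc k +ℕ r *ℕ m) ≡ ballot r (k +ℕ r *ℕ m +ℕ m) m
  pow-coeff-on-progression zero k = trans (cong (pow z (suc k)) k+r*0≡k) (pow-coeff-diag (suc k))
    where
      k+r*0≡k : suc k +ℕ r *ℕ 0 ≡ suc k
      k+r*0≡k = trans (cong (suc k +ℕ_) (ℕ.*-zeroʳ r)) (ℕ.+-identityʳ (suc k))
  pow-coeff-on-progression (suc m) zero = begin
    pow z 1 (suc (r *ℕ suc m))
      ≡⟨ pow-coeff-suc 0 (r *ℕ suc m) ⟩
    one (r *ℕ suc m) + pow z (suc r) (suc (r *ℕ suc m))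
      ≡⟨ cong₂ _+_ (one-nonZero (r *ℕ suc m) {{ℕ.m*n≢0 r (suc m)}})
                   (cong (pow z (suc r) ∘ suc) (ℕ.*-suc r m)) ⟩
    0ℚ + pow z (suc r) (suc r +ℕ r *ℕ m)
      ≡⟨ +-identityˡ _ ⟩
    pow z (suc r) (suc r +ℕ r *ℕ m)
      ≡⟨ pow-coeff-on-progression m r ⟩
    ballot r (r +ℕ r *ℕ m +ℕ m) m
      ≡⟨ cong (λ M → ballot r (M +ℕ m) m) (ℕ.*-suc r m) ⟨
    ballot r N m
      ≡⟨ +-identityˡ _ ⟨
    0ℚ + ballot r N m
      ≡⟨ cong (_+ ballot r N m) (ballot-vanish r m) ⟨
    ballot r N (suc m) + ballot r N m
      ≡⟨ ballot-suc r N m ⟨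
    ballot r (suc N) (suc m)
      ≡⟨ cong (λ M → ballot r M (suc m)) (ℕ.+-suc (r *ℕ suc m) m) ⟨
    ballot r (r *ℕ suc m +ℕ suc m) (suc m) ∎
    where
      N = r *ℕ suc m +ℕ m
  pow-coeff-on-progression (suc m) (suc k) = begin
    pow z (suc (suc k)) (suc n)
      ≡⟨ pow-coeff-suc (suc k) n ⟩
    pow z (suc k) n + pow z (suc (suc k) +ℕ r) (suc n)
      ≡⟨ cong₂ _+_ (pow-coeff-on-progression (suc m) k)
                   (trans (cong (pow z (suc (suc k +ℕ r))) (index k r m))
                          (pow-coeff-on-progression m (suc k +ℕ r))) ⟩
    ballot r N (suc m) + ballot r (suc k +ℕ r +ℕ r *ℕ m +ℕ m) m
      ≡⟨ cong (λ M → ballot r N (suc m) + ballot r M m) (index′ k r m) ⟩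
    ballot r N (suc m) + ballot r N m
      ≡⟨ ballot-suc r N m ⟨
    ballot r (suc N) (suc m) ∎
    where
      n = suc k +ℕ r *ℕ suc m
      N = k +ℕ r *ℕ suc m +ℕ suc m
      index : ∀ k r m → suc (suc k +ℕ r *ℕ suc m) ≡ suc (suc k +ℕ r) +ℕ r *ℕ m
      index = solve-∀
      index′ : ∀ k r m → suc k +ℕ r +ℕ r *ℕ m +ℕ m ≡ k +ℕ r *ℕ suc m +ℕ suc m
      index′ = solve-∀

  pow-coeff-suc-vanish : ∀ k n → pow z k n ≡ 0ℚ → pow z (suc k +ℕ r) (suc n) ≡ 0ℚ →
                         pow z (suc k) (suc n) ≡ 0ℚ
  pow-coeff-suc-vanish k n p≡0 q≡0 =
    trans (pow-coeff-suc k n) (trans (cong₂ _+_ p≡0 q≡0) (+-identityˡ 0ℚ))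

  pow-coeff-off-progression : ∀ ρ → suc ρ < r → ∀ m k → pow z k (k +ℕ suc ρ +ℕ r *ℕ m) ≡ 0ℚ
  pow-coeff-off-progression ρ ρ<r m       zero    = refl
  pow-coeff-off-progression ρ ρ<r zero    (suc k) =
    pow-coeff-suc-vanish k _ (pow-coeff-off-progression ρ ρ<r zero k)
                             (pow-vanish z z₀≡0 (suc k +ℕ r) _ (s≤s k+ρ+r*0<k+r))
    where
      k+ρ+r*0≡k+ρ : k +ℕ suc ρ +ℕ r *ℕ 0 ≡ k +ℕ suc ρ
      k+ρ+r*0≡k+ρ = trans (cong (k +ℕ suc ρ +ℕ_) (ℕ.*-zeroʳ r)) (ℕ.+-identityʳ (k +ℕ suc ρ))
      k+ρ+r*0<k+r : k +ℕ suc ρ +ℕ r *ℕ 0 < k +ℕ r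
      k+ρ+r*0<k+r = subst (_< k +ℕ r) (sym k+ρ+r*0≡k+ρ) (ℕ.+-monoʳ-< k ρ<r)
  pow-coeff-off-progression ρ ρ<r (suc m) (suc k) =
    pow-coeff-suc-vanish k _ (pow-coeff-off-progression ρ ρ<r (suc m) k)
                             (trans (cong (pow z (suc k +ℕ r)) (index k ρ r m))
                                    (pow-coeff-off-progression ρ ρ<r m (suc k +ℕ r)))
    where
      index : ∀ k ρ r m → suc (k +ℕ suc ρ +ℕ r *ℕ suc m) ≡ suc k +ℕ r +ℕ suc ρ +ℕ r *ℕ m
      index = solve-∀

  pow-coeff-vanish : ∀ n k → (∀ q → ¬ (n ≡ k +ℕ r *ℕ q)) → pow z k n ≡ 0ℚ
  pow-coeff-vanish n k n∉k+rℕ with n ℕ.<? k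
  ... | yes n<k = pow-vanish z z₀≡0 k n n<k
  ... | no n≮k  = by-residue ((n ∸ k) % r) (m%n<n (n ∸ k) r) n≡k+ρ+rq
    where
      q = (n ∸ k) div r
      n≡k+ρ+rq : n ≡ k +ℕ (n ∸ k) % r +ℕ r *ℕ q
      n≡k+ρ+rq = begin
        n                                  ≡⟨ ℕ.m+[n∸m]≡n (ℕ.≮⇒≥ n≮k) ⟨
        k +ℕ (n ∸ k)                       ≡⟨ cong (k +ℕ_) (m≡m%n+[m/n]*n (n ∸ k) r) ⟩
        k +ℕ ((n ∸ k) % r +ℕ q *ℕ r)       ≡⟨ ℕ.+-assoc k _ _ ⟨
        k +ℕ (n ∸ k) % r +ℕ q *ℕ r         ≡⟨ cong (k +ℕ (n ∸ k) % r +ℕ_) (ℕ.*-comm q r) ⟩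
        k +ℕ (n ∸ k) % r +ℕ r *ℕ q         ∎
      by-residue : ∀ ρ → ρ < r → n ≡ k +ℕ ρ +ℕ r *ℕ q → pow z k n ≡ 0ℚ
      by-residue zero    _   n≡k+rq =
        ⊥-elim (n∉k+rℕ q (trans n≡k+rq (cong (_+ℕ r *ℕ q) (ℕ.+-identityʳ k))))
      by-residue (suc ρ) ρ<r n≡k+ρ+rq =
        subst (λ n → pow z k n ≡ 0ℚ) (sym n≡k+ρ+rq) (pow-coeff-off-progression ρ ρ<r q k)

  ξ-on-progression : ∀ {i} → i < r → ∀ q → let μ = i +ℕ r *ℕ q in ξ z i μ ≡ ι ((μ +ℕ μ div r) C μ)
  ξ-on-progression {i} i<r q = begin
    ι (suc μ) * (w * pow z (suc i) (suc μ))
      ≡⟨ cong (λ c → ι (suc μ) * (w * c)) (pow-coeff-on-progression q i) ⟩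
    ι (suc μ) * (w * ballot r (μ +ℕ q) q)
      ≡⟨ solve 3 (λ x w b → x :* (w :* b) := w :* (x :* b)) refl (ι (suc μ)) w (ballot r (μ +ℕ q) q) ⟩
    w * (ι (suc μ) * ballot r (μ +ℕ q) q)
      ≡⟨ cong (w *_) (lagrange-prefactor r i q) ⟩
    w * (ι (suc i) * ι ((μ +ℕ q) C q))
      ≡⟨ *-assoc w (ι (suc i)) _ ⟨
    w * ι (suc i) * ι ((μ +ℕ q) C q)
      ≡⟨ cong (_* ι ((μ +ℕ q) C q)) (1/[1+n]*[1+n]≡1 i) ⟩
    1ℚ * ι ((μ +ℕ q) C q)
      ≡⟨ *-identityˡ _ ⟩
    ι ((μ +ℕ q) C q)
      ≡⟨ cong ι (C-swap μ q) ⟩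
    ι ((μ +ℕ q) C μ)
      ≡⟨ cong (λ d → ι ((μ +ℕ d) C μ)) (on-progression-div r q i<r) ⟨
    ι ((μ +ℕ μ div r) C μ) ∎
    where
      μ = i +ℕ r *ℕ q
      w = + 1 / suc i

  ξ-off-progression : ∀ i μ → (∀ q → ¬ (μ ≡ i +ℕ r *ℕ q)) → ξ z i μ ≡ 0ℚ
  ξ-off-progression i μ μ∉i+rℕ = begin
    ι (suc μ) * (w * pow z (suc i) (suc μ))
      ≡⟨ cong (λ c → ι (suc μ) * (w * c)) (pow-coeff-vanish (suc μ) (suc i) 1+μ∉1+i+rℕ) ⟩
    ι (suc μ) * (w * 0ℚ)
      ≡⟨ cong (ι (suc μ) *_) (*-zeroʳ w) ⟩
    ι (suc μ) * 0ℚ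
      ≡⟨ *-zeroʳ (ι (suc μ)) ⟩
    0ℚ ∎
    where
      w = + 1 / suc i
      1+μ∉1+i+rℕ : ∀ q → ¬ (suc μ ≡ suc i +ℕ r *ℕ q)
      1+μ∉1+i+rℕ q = μ∉i+rℕ q ∘ ℕ.suc-injective

mainTheorem2 : (r : ℕ) → .{{_ : NonZero r}} → (z : Series) →
    z 0 ≡ 0ℚ → z 1 ≡ 1ℚ →
    (∀ n → X n ≡ (z ⊛ (one ⊖ pow z r)) n) →
    (i : ℕ) → i < r → (μ : ℕ) →
    ((+ r ∣ (+ μ - + i)) → ξ z i μ ≡ + ((μ +ℕ (μ div r)) C μ) / 1)
    × (¬ (+ r ∣ (+ μ - + i)) → ξ z i μ ≡ 0ℚ)
mainTheorem2 r z z₀≡0 _ x≡z[1-zʳ] i i<r μ = on , off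
  where
    open Coefficients r z z₀≡0 x≡z[1-zʳ]
    on : + r ∣ (+ μ - + i) → ξ z i μ ≡ ι ((μ +ℕ μ div r) C μ)
    on r∣μ-i =
      let q , μ≡i+rq = ∣⇒on-progression i<r r∣μ-i
      in subst (λ μ → ξ z i μ ≡ ι ((μ +ℕ μ div r) C μ)) (sym μ≡i+rq) (ξ-on-progression i<r q)
    off : ¬ (+ r ∣ (+ μ - + i)) → ξ z i μ ≡ 0ℚ
    off r∤μ-i = ξ-off-progression i μ λ q μ≡i+rq →
      r∤μ-i (subst (λ μ → + r ∣ (+ μ - + i)) (sym μ≡i+rq) (on-progression⇒∣ r i q))
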